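{- Let $r\geq3$, $t\geq1$ and $n>k_1\geq\cdots\geq k_r\geq t+2$. Let $\mathcal{F}_1\subseteq\Pi_{k_1}(n),\ldots,\mathcal{F}_r\subseteq\Pi_{k_r}(n)$ be non-trivial $r$-cross $t$-intersecting. If $s_i=t$ for all $i\in[r]$, then: (i) for each $j\in[r]$, every $t$-cover of $\mathcal{G}_j$ is a $(t+1)$-cover of all but at most one of the families $\mathcal{F}_i$, $i\in[r]\setminus\{j\}$; (ii) $\tau_t(\mathcal{F}_i)=t$ and $\tau_t(\mathcal{G}_i)\geq t+2$ for all $i\in[r]$.
   Context: $\Pi_k(n)$ is the set of partitions of $[n]$ into $k$ non-empty blocks. $P\cap Q$ is the set of common blocks of partitions; $\cap\mathcal{F}$ the set of blocks common to all members of $\mathcal{F}$. $\mathcal{F}_1,\ldots,\mathcal{F}_r$ are $r$-cross $t$-intersecting if $|F_1\cap\cdots\cap F_r|\geq t$ for all $F_i\in\mathcal{F}_i$; non-trivial if $|\bigcap_i(\cap\mathcal{F}_i)|<t$. For $i\in[r]$, $\mathcal{G}_i=\{\bigcap_{j\neq i}F_j:F_j\in\mathcal{F}_j,\ j\neq i\}$ and $s_i=\min\{|G|:G\in\mathcal{G}_i\}$ ($|G|$ = number of blocks). For $u\geq1$, a $u$-cover of a family $\mathcal{P}$ of partitions is a partition (blocks need not cover $[n]$) sharing at least $u$ blocks with every member of $\mathcal{P}$; $\tau_t(\mathcal{P})$ is the minimum number of blocks of a $t$-cover of $\mathcal{P}$. -}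

module Defs where

open import Data.Nat using (ℕ; zero; suc; _≤_; _<_; _+_)
open import Data.Bool using (true; false) renaming (_≟_ to _≟ᵇ_)
open import Data.Fin using (Fin; _≟_)
open import Data.Fin.Subset using (Subset; Nonempty; Empty; _∩_) renaming (_∈_ to _∈ˢ_)
open import Data.Fin.Subset.Properties using (nonempty?)
open import Data.Vec using (_∷_; [])
open import Data.Vec.Properties using (≡-dec)
open import Data.List using (List; []; _∷_; _++_; map; filter; length; tabulate; allFin)
open import Data.List.Relation.Unary.All using (All; all?)
open import Data.List.Relation.Unary.Any using (Any)
open import Data.List.Relation.Unary.AllPairs using (AllPairs)
open import Data.List.Relation.Unary.Unique.Propositional using (Unique)
open import Data.List.Membership.Propositional using (_∈_)
open import Data.Product using (Σ; ∃; _×_; _,_)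
open import Relation.Nullary using (¬_; ¬?)
open import Relation.Binary.PropositionalEquality using (_≡_; _≢_)
open import Relation.Binary.Definitions using (DecidableEquality)

-- A block is a subset of [n] = Fin n (non-emptiness is imposed where needed).
Block : ℕ → Set
Block n = Subset n

_≟ᴮ_ : ∀ {n} → DecidableEquality (Block n)
_≟ᴮ_ = ≡-dec _≟ᵇ_

module _ {n : ℕ} where
  open import Data.List.Membership.DecPropositional (_≟ᴮ_ {n}) public
    using () renaming (_∈?_ to _∈ᴮ?_)

allSubsets : (n : ℕ) → List (Subset n)
allSubsets zero = [] ∷ []
allSubsets (suc n) = map (true ∷_) (allSubsets n) ++ map (false ∷_) (allSubsets n)

allBlocks : (n : ℕ) → List (Block n)
allBlocks n = filter nonempty? (allSubsets n)

IsPartialPartition : ∀ {n} → List (Block n) → Set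
IsPartialPartition P = Unique P × All Nonempty P × AllPairs (λ A B → Empty (A ∩ B)) P

IsPartition : (n k : ℕ) → List (Block n) → Set
IsPartition n k P = IsPartialPartition P × (∀ (x : Fin n) → Any (x ∈ˢ_) P) × length P ≡ k

_∩ᴾ_ : ∀ {n} → List (Block n) → List (Block n) → List (Block n)
P ∩ᴾ Q = filter (_∈ᴮ? Q) P

-- Blocks common to all members of a list of block collections
-- (for the empty list: all blocks of [n], the usual convention).
⋂ : ∀ {n} → List (List (Block n)) → List (Block n)
⋂ {n} Ps = filter (λ B → all? (B ∈ᴮ?_) Ps) (allBlocks n)

Fam : ℕ → Set₁
Fam n = List (Block n) → Set

⟨_⟩ : ∀ {n} → List (List (Block n)) → Fam n
⟨ F ⟩ P = P ∈ F

𝒢 : ∀ {n r} → (Fin r → List (List (Block n))) → Fin r → Fam n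
𝒢 {n} {r} F i G =
  Σ (Fin r → List (Block n)) λ P →
    (∀ j → j ≢ i → P j ∈ F j) ×
    G ≡ ⋂ (map P (filter (λ j → ¬? (j ≟ i)) (allFin r)))

CrossIntersecting : ∀ {n r} → ℕ → (Fin r → List (List (Block n))) → Set
CrossIntersecting {n} {r} t F =
  ∀ (P : Fin r → List (Block n)) → (∀ i → P i ∈ F i) → t ≤ length (⋂ (tabulate P))

NonTrivial : ∀ {n r} → ℕ → (Fin r → List (List (Block n))) → Set
NonTrivial t F = length (⋂ (tabulate (λ i → ⋂ (F i)))) < t

MinSize≡ : ∀ {n} → Fam n → ℕ → Set
MinSize≡ 𝒫 m = (∃ λ G → 𝒫 G × length G ≡ m) × (∀ G → 𝒫 G → m ≤ length G)

IsCover : ∀ {n} → ℕ → Fam n → List (Block n) → Set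
IsCover u 𝒫 C = IsPartialPartition C × (∀ Q → 𝒫 Q → u ≤ length (C ∩ᴾ Q))

τ≡ : ∀ {n} → ℕ → Fam n → ℕ → Set
τ≡ u 𝒫 m = (∃ λ C → IsCover u 𝒫 C × length C ≡ m) × (∀ C → IsCover u 𝒫 C → m ≤ length C)

-- τ_u(𝒫) ≥ m  (min over the empty set counts as ∞)
τ≥ : ∀ {n} → ℕ → Fam n → ℕ → Set
τ≥ u 𝒫 m = ∀ C → IsCover u 𝒫 C → m ≤ length C

-- A member G = ⋂_{l ≠ j} Q_l of 𝒢ⱼ with at most t blocks lies inside every P ∈ ℱⱼ: adding P
-- to the selection gives an r-fold intersection inside G with at least t blocks. Hence a
-- block lying in every member of every ℱ_l, l ≠ j, lies in every member of ℱⱼ as well, and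
-- t such blocks contradict non-triviality.
-- (i) Let C be a t-cover of 𝒢ⱼ and let A ∈ ℱ_{i₁}, B ∈ ℱ_{i₂} (i₁ ≠ i₂, both ≠ j) meet C in
-- at most t blocks. For any selection through B the t-cover condition pushes C ∩ B into all
-- other selected members; so C ∩ B ⊆ A, and selecting through A then puts C ∩ B into every
-- member of every ℱ_l, l ≠ j. These are t common blocks.
-- (ii) The t-block member G of 𝒢ᵢ is a t-cover of ℱᵢ. A t-cover C of 𝒢ᵢ contains G; if
-- |C| ≤ t + 1, then by (i) C lies inside every member of every family except ℱᵢ and one
-- ℱ_{l′}, so the blocks of G are common to all families but ℱ_{l′}, hence to all.
module Submission where

open import Defs
open import Data.Nat using (ℕ; zero; suc; z≤n; s≤s; _≤_; _<_; _+_; _≤?_)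
open import Data.Nat.Properties
  using ( ≤-trans; ≤-reflexive; <-irrefl; <-≤-trans; ≤-<-trans; <⇒≤; <⇒≱; ≰⇒>
        ; m<1+n⇒m≤n; +-comm; +-suc)
open import Data.Bool using (Bool; true; false)
open import Data.Fin using (Fin; _≟_) renaming (_≤_ to _≤ᶠ_; zero to fzero; suc to fsuc)
open import Data.Fin.Properties using (all?; ¬∀⟶∃¬)
open import Data.Fin.Subset using (Subset; Nonempty; Empty; _∩_)
open import Data.Fin.Subset.Properties using (nonempty?; ∩-comm)
open import Data.Vec using (_∷_; [])
open import Data.Vec.Functional using (updateAt)
open import Data.Vec.Functional.Properties using (updateAt-updates; updateAt-minimal)
open import Data.List using (List; []; _∷_; map; filter; length; tabulate; allFin)
open import Data.List.Properties using (length-filter; filter-notAll)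
open import Data.List.Relation.Unary.All as All using (All; []; _∷_)
import Data.List.Relation.Unary.All.Properties as All
open import Data.List.Relation.Unary.All.Properties.Core using (¬All⇒Any¬)
open import Data.List.Relation.Unary.Any as Any using (here; there)
open import Data.List.Relation.Unary.AllPairs using (AllPairs; []; _∷_)
open import Data.List.Relation.Unary.Unique.Propositional using (Unique)
import Data.List.Relation.Unary.Unique.Propositional.Properties as Unique
open import Data.List.Membership.Propositional using (_∈_; _∉_; find)
open import Data.List.Membership.Propositional.Properties
  using (∈-filter⁺; ∈-filter⁻; ∈-map⁺; ∈-map⁻; ∈-++⁺ˡ; ∈-++⁺ʳ; ∈-allFin)
open import Data.List.Relation.Binary.Subset.Propositional using (_⊆_)
open import Data.Product using (∃; _×_; _,_; proj₁; proj₂)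
open import Data.Sum using (_⊎_; inj₁; inj₂)
open import Data.Empty using (⊥; ⊥-elim)
open import Function using (const; _∘_)
open import Relation.Nullary using (¬_; Dec; yes; no; ¬?)
open import Relation.Nullary.Decidable using (map′; decidable-stable; _⊎-dec_)
open import Relation.Unary using (Pred; Decidable)
open import Relation.Binary.Core using (Rel)
open import Relation.Binary.Definitions using (DecidableEquality; Symmetric)
open import Relation.Binary.PropositionalEquality using (_≡_; _≢_; refl; sym; trans; subst)

module _ {a} {A : Set a} (_≟ᴬ_ : DecidableEquality A) where
  open import Data.List.Membership.DecPropositional _≟ᴬ_ using (_∈?_)

  private
    without : A → List A → List A
    without x = filter (λ y → ¬? (x ≟ᴬ y))

    ⊆-without : ∀ {x xs ys} → x ∉ xs → xs ⊆ ys → xs ⊆ without x ys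
    ⊆-without x∉xs xs⊆ys y∈xs = ∈-filter⁺ _ (xs⊆ys y∈xs) (λ { refl → x∉xs y∈xs })

    length-without : ∀ {x ys} → x ∈ ys → length (without x ys) < length ys
    length-without x∈ys = filter-notAll _ _ (Any.map (λ x≡y x≢y → x≢y x≡y) x∈ys)

  length-mono-⊆ : ∀ {xs ys} → Unique xs → xs ⊆ ys → length xs ≤ length ys
  length-mono-⊆ {[]} _ _ = z≤n
  length-mono-⊆ {x ∷ xs} (x∉xs ∷ xs!) x∷xs⊆ys =
    ≤-trans (s≤s (length-mono-⊆ xs! (⊆-without x∉ xs⊆ys))) (length-without (x∷xs⊆ys (here refl)))
    where
    xs⊆ys : xs ⊆ _
    xs⊆ys = x∷xs⊆ys ∘ there
    x∉ : x ∉ xs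
    x∉ x∈xs = All.lookup x∉xs x∈xs refl

  ⊆∧length≤⇒⊇ : ∀ {xs ys} → Unique xs → xs ⊆ ys → length ys ≤ length xs → ys ⊆ xs
  ⊆∧length≤⇒⊇ {xs} {ys} xs! xs⊆ys |ys|≤|xs| {y} y∈ys with y ∈? xs
  ... | yes y∈xs = y∈xs
  ... | no y∉xs = ⊥-elim (<-irrefl refl (<-≤-trans shorter |ys|≤|xs|))
    where
    shorter : length xs < length ys
    shorter = ≤-<-trans (length-mono-⊆ xs! (⊆-without y∉xs xs⊆ys)) (length-without y∈ys)

module _ {a ℓ} {A : Set a} {R : Rel A ℓ} (R-sym : Symmetric R) where

  private
    AllPairs-lookup : ∀ {ys x z} → AllPairs R ys → x ∈ ys → z ∈ ys → x ≢ z → R x z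
    AllPairs-lookup (_ ∷ _) (here refl) (here refl) x≢z = ⊥-elim (x≢z refl)
    AllPairs-lookup (Rx ∷ _) (here refl) (there z∈) _ = All.lookup Rx z∈
    AllPairs-lookup (Rz ∷ _) (there x∈) (here refl) _ = R-sym (All.lookup Rz x∈)
    AllPairs-lookup (_ ∷ ys) (there x∈) (there z∈) x≢z = AllPairs-lookup ys x∈ z∈ x≢z

  AllPairs-⊆ : ∀ {xs ys} → AllPairs R ys → Unique xs → xs ⊆ ys → AllPairs R xs
  AllPairs-⊆ ys [] _ = []
  AllPairs-⊆ ys (x∉xs ∷ xs!) x∷xs⊆ys =
    All.tabulate (λ z∈ → AllPairs-lookup ys (x∷xs⊆ys (here refl)) (x∷xs⊆ys (there z∈))
                                         (All.lookup x∉xs z∈))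
    ∷ AllPairs-⊆ ys xs! (x∷xs⊆ys ∘ there)

all-but-one : ∀ {r p} {P : Pred (Fin r) p} → Decidable P → Fin r →
              (∀ x y → ¬ P x → ¬ P y → x ≡ y) → ∃ λ x → ∀ y → y ≢ x → P y
all-but-one {r} {P = P} P? x₀ at-most-one with all? P?
... | yes all = x₀ , λ y _ → all y
... | no ¬all with ¬∀⟶∃¬ r P P? ¬all
...   | x , ¬Px = x , λ y y≢x → decidable-stable (P? y) (λ ¬Py → y≢x (at-most-one y x ¬Py ¬Px))

_[_]≔_ : ∀ {a r} {A : Set a} → (Fin r → A) → Fin r → A → Fin r → A
Q [ l ]≔ v = updateAt Q l (const v)

allSubsets-complete : ∀ {n} (s : Subset n) → s ∈ allSubsets n
allSubsets-complete [] = here refl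
allSubsets-complete (true ∷ s) = ∈-++⁺ˡ (∈-map⁺ (true ∷_) (allSubsets-complete s))
allSubsets-complete {suc n} (false ∷ s) =
  ∈-++⁺ʳ (map (true ∷_) (allSubsets n)) (∈-map⁺ (false ∷_) (allSubsets-complete s))

allSubsets-unique : ∀ n → Unique (allSubsets n)
allSubsets-unique zero = [] ∷ []
allSubsets-unique (suc n) =
  Unique.++⁺ (Unique.map⁺ ∷-injectiveʳ (allSubsets-unique n))
             (Unique.map⁺ ∷-injectiveʳ (allSubsets-unique n)) heads-differ
  where
  ∷-injectiveʳ : ∀ {b : Bool} {x y : Subset n} → b ∷ x ≡ b ∷ y → x ≡ y
  ∷-injectiveʳ refl = refl
  heads-differ : ∀ {s} → s ∈ map (true ∷_) (allSubsets n) × s ∈ map (false ∷_) (allSubsets n) → ⊥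
  heads-differ (s∈ , s∈′) with ∈-map⁻ (true ∷_) s∈ | ∈-map⁻ (false ∷_) s∈′
  ... | _ , _ , refl | _ , _ , ()

module _ {n : ℕ} where

  ⋂-unique : (Ps : List (List (Block n))) → Unique (⋂ Ps)
  ⋂-unique Ps = Unique.filter⁺ _ (Unique.filter⁺ _ (allSubsets-unique n))

  ∈-⋂⁻ : ∀ {Ps} {B : Block n} → B ∈ ⋂ Ps → Nonempty B × All (B ∈_) Ps
  ∈-⋂⁻ {Ps} B∈ with ∈-filter⁻ (λ B → All.all? (B ∈ᴮ?_) Ps) {xs = allBlocks n} B∈
  ... | B∈blocks , B∈all = proj₂ (∈-filter⁻ nonempty? {xs = allSubsets n} B∈blocks) , B∈all

  ∈-⋂⁺ : ∀ {Ps} {B : Block n} → Nonempty B → All (B ∈_) Ps → B ∈ ⋂ Ps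
  ∈-⋂⁺ {Ps} {B} B≠∅ B∈all =
    ∈-filter⁺ (λ B → All.all? (B ∈ᴮ?_) Ps) (∈-filter⁺ nonempty? (allSubsets-complete B) B≠∅) B∈all

  ∈-∩ᴾ⁻ : ∀ {C Q : List (Block n)} {b} → b ∈ C ∩ᴾ Q → b ∈ C × b ∈ Q
  ∈-∩ᴾ⁻ {C = C} {Q} = ∈-filter⁻ (_∈ᴮ? Q) {xs = C}

  ∈-∩ᴾ⁺ : ∀ {C Q : List (Block n)} {b} → b ∈ C → b ∈ Q → b ∈ C ∩ᴾ Q
  ∈-∩ᴾ⁺ {Q = Q} = ∈-filter⁺ (_∈ᴮ? Q)

  ∩ᴾ-unique : ∀ {C : List (Block n)} Q → Unique C → Unique (C ∩ᴾ Q)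
  ∩ᴾ-unique Q = Unique.filter⁺ (_∈ᴮ? Q)

  ∩ᴾ-full⇒⊆ : ∀ {C Q : List (Block n)} → Unique C → length C ≤ length (C ∩ᴾ Q) → C ⊆ Q
  ∩ᴾ-full⇒⊆ {C} {Q} C! full =
    proj₂ ∘ ∈-∩ᴾ⁻ {C = C} ∘ ⊆∧length≤⇒⊇ _≟ᴮ_ (∩ᴾ-unique Q C!) (proj₁ ∘ ∈-∩ᴾ⁻ {C = C}) full

  ∩ᴾ-full⇒⊇ : ∀ {C Q : List (Block n)} → Unique C → length Q ≤ length (C ∩ᴾ Q) → Q ⊆ C
  ∩ᴾ-full⇒⊇ {C} {Q} C! full =
    proj₁ ∘ ∈-∩ᴾ⁻ {C = C} ∘ ⊆∧length≤⇒⊇ _≟ᴮ_ (∩ᴾ-unique Q C!) (proj₂ ∘ ∈-∩ᴾ⁻ {C = C}) full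

  IsPartialPartition-⊆ : ∀ {X P : List (Block n)} →
                         Unique X → X ⊆ P → IsPartialPartition P → IsPartialPartition X
  IsPartialPartition-⊆ X! X⊆P (_ , P≠∅ , P-disjoint) =
    X! , All.tabulate (All.lookup P≠∅ ∘ X⊆P) , AllPairs-⊆ disjoint-sym P-disjoint X! X⊆P
    where
    disjoint-sym : Symmetric (λ (A B : Block n) → Empty (A ∩ B))
    disjoint-sym {A} {B} = subst Empty (∩-comm A B)

  cover-length : ∀ {u 𝓕} {P C : List (Block n)} → P ∈ 𝓕 → IsCover u ⟨ 𝓕 ⟩ C → u ≤ length C
  cover-length {C = C} P∈ cover = ≤-trans (proj₂ cover _ P∈) (length-filter _ C)

  module _ (u : ℕ) (𝓕 : List (List (Block n)))
           {C : List (Block n)} (C-pp : IsPartialPartition C) where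

    IsCover? : Dec (IsCover u ⟨ 𝓕 ⟩ C)
    IsCover? = map′ (λ all → C-pp , λ _ → All.lookup all) (λ cover → All.tabulate (proj₂ cover _))
                    (All.all? (λ Q → u ≤? length (C ∩ᴾ Q)) 𝓕)

    ¬IsCover⇒thin-member : ¬ IsCover u ⟨ 𝓕 ⟩ C → ∃ λ A → A ∈ 𝓕 × length (C ∩ᴾ A) < u
    ¬IsCover⇒thin-member ¬cover
      with find (¬All⇒Any¬ (λ Q → u ≤? length (C ∩ᴾ Q)) 𝓕
                   (λ all → ¬cover (C-pp , λ _ → All.lookup all)))
    ... | A , A∈ , u≰ = A , A∈ , ≰⇒> u≰

module _ {r : ℕ} where

  others : Fin r → List (Fin r)
  others j = filter (λ l → ¬? (l ≟ j)) (allFin r)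

  module _ {n : ℕ} where

    ∈-⋂-others⁻ : ∀ {j} {Q : Fin r → List (Block n)} {B} →
                  B ∈ ⋂ (map Q (others j)) → ∀ l → l ≢ j → B ∈ Q l
    ∈-⋂-others⁻ {j} B∈ l l≢j =
      All.lookup (All.map⁻ (proj₂ (∈-⋂⁻ B∈))) (∈-filter⁺ (λ l → ¬? (l ≟ j)) (∈-allFin l) l≢j)

    ∈-⋂-others⁺ : ∀ {j} {Q : Fin r → List (Block n)} {B} →
                  Nonempty B → (∀ l → l ≢ j → B ∈ Q l) → B ∈ ⋂ (map Q (others j))
    ∈-⋂-others⁺ {j} B≠∅ B∈Q = ∈-⋂⁺ B≠∅ (All.map⁺ (All.tabulate λ {l} l∈ →
      B∈Q l (proj₂ (∈-filter⁻ (λ l → ¬? (l ≟ j)) {xs = allFin r} l∈))))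

    module _ (F : Fin r → List (List (Block n))) where

      Selection : Fin r → (Fin r → List (Block n)) → Set
      Selection j Q = ∀ l → l ≢ j → Q l ∈ F l

      Selection-≔ : ∀ {j Q l v} → Selection j Q → v ∈ F l → Selection j (Q [ l ]≔ v)
      Selection-≔ {Q = Q} {l} {v} sel v∈ m m≢j with m ≟ l
      ... | yes refl = subst (_∈ F m) (sym (updateAt-updates m Q)) v∈
      ... | no m≢l = subst (_∈ F m) (sym (updateAt-minimal m l Q m≢l)) (sel m m≢j)

      Common : Block n → Set
      Common b = ∀ i → All (b ∈_) (F i)

      common-length<t : ∀ {t D} → NonTrivial t F → Unique D → All Nonempty D →
                        (∀ {b} → b ∈ D → Common b) → length D < t
      common-length<t {D = D} nonTrivial D! D≠∅ common =
        ≤-<-trans (length-mono-⊆ _≟ᴮ_ D! D⊆core) nonTrivial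
        where
        D⊆core : D ⊆ ⋂ (tabulate (λ i → ⋂ (F i)))
        D⊆core b∈ = ∈-⋂⁺ b≠∅ (All.tabulate⁺ λ i → ∈-⋂⁺ b≠∅ (common b∈ i))
          where b≠∅ = All.lookup D≠∅ b∈

      𝒢-unique : ∀ {j G} → 𝒢 F j G → Unique G
      𝒢-unique (Q , _ , refl) = ⋂-unique _

      𝒢-nonempty : ∀ {j G} → 𝒢 F j G → All Nonempty G
      𝒢-nonempty (Q , _ , refl) = All.tabulate (proj₁ ∘ ∈-⋂⁻)

      𝒢-partial : (∀ {l P} → P ∈ F l → IsPartialPartition P) →
                  ∀ {j G l} → 𝒢 F j G → l ≢ j → IsPartialPartition G
      𝒢-partial partial {l = l} g@(Q , sel , refl) l≢j =
        IsPartialPartition-⊆ (𝒢-unique g) (λ b∈ → ∈-⋂-others⁻ b∈ l l≢j) (partial (sel l l≢j))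

      module _ {t : ℕ} (cross : CrossIntersecting t F) where

        small-𝒢-⊆ : ∀ {j G P} → 𝒢 F j G → length G ≤ t → P ∈ F j → G ⊆ P
        small-𝒢-⊆ {j} {G} {P} (Q , sel , refl) |G|≤t P∈ b∈G =
          subst (_ ∈_) (updateAt-updates j Q) (All.tabulate⁻ (proj₂ (∈-⋂⁻ (G⊆X b∈G))) j)
          where
          Q′ = Q [ j ]≔ P
          Q′-complete : ∀ l → Q′ l ∈ F l
          Q′-complete l with l ≟ j
          ... | yes refl = subst (_∈ F l) (sym (updateAt-updates l Q)) P∈
          ... | no l≢j = Selection-≔ sel P∈ l l≢j
          X = ⋂ (tabulate Q′)
          X⊆G : X ⊆ G
          X⊆G b∈X with ∈-⋂⁻ b∈X
          ... | b≠∅ , b∈Q′ = ∈-⋂-others⁺ b≠∅ λ l l≢j →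
            subst (_ ∈_) (updateAt-minimal l j Q l≢j) (All.tabulate⁻ b∈Q′ l)
          G⊆X : G ⊆ X
          G⊆X = ⊆∧length≤⇒⊇ _≟ᴮ_ (⋂-unique (tabulate Q′)) X⊆G (≤-trans |G|≤t (cross Q′ Q′-complete))

        common-away-from⇒common : ∀ {j G b} → 𝒢 F j G → length G ≤ t → Nonempty b →
                                   (∀ l → l ≢ j → All (b ∈_) (F l)) → Common b
        common-away-from⇒common {j} {G} g@(Q , sel , refl) |G|≤t b≠∅ common-away i with i ≟ j
        ... | yes refl = All.tabulate λ P∈ → small-𝒢-⊆ g |G|≤t P∈ b∈G
          where
          b∈G : _ ∈ G
          b∈G = ∈-⋂-others⁺ b≠∅ λ l l≢j → All.lookup (common-away l l≢j) (sel l l≢j)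
        ... | no i≢j = common-away i i≢j

      module _ {t j C} (cover : IsCover t (𝒢 F j) C) {G} (g : 𝒢 F j G) where

        private
          C! : Unique C
          C! = proj₁ (proj₁ cover)

          ∩-others-⊆ : ∀ Q {m} → m ≢ j → C ∩ᴾ ⋂ (map Q (others j)) ⊆ C ∩ᴾ Q m
          ∩-others-⊆ Q m≢j b∈ with ∈-∩ᴾ⁻ {C = C} b∈
          ... | b∈C , b∈⋂ = ∈-∩ᴾ⁺ b∈C (∈-⋂-others⁻ b∈⋂ _ m≢j)

          cover-selection : ∀ {Q} → Selection j Q → t ≤ length (C ∩ᴾ ⋂ (map Q (others j)))
          cover-selection {Q} sel = proj₂ cover _ (Q , sel , refl)

          Q₀ = proj₁ g
          sel₀ = proj₁ (proj₂ g)

        cover-meets : ∀ {m Y} → m ≢ j → Y ∈ F m → t ≤ length (C ∩ᴾ Y)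
        cover-meets {m} {Y} m≢j Y∈ = subst (λ Z → t ≤ length (C ∩ᴾ Z)) (updateAt-updates m Q₀)
          (≤-trans (cover-selection (Selection-≔ sel₀ Y∈))
                   (length-mono-⊆ _≟ᴮ_ (∩ᴾ-unique _ C!) (∩-others-⊆ (Q₀ [ m ]≔ Y) m≢j)))

        -- Select Y at m and an arbitrary P at l: as C ∩ Y has at most t blocks, the t-cover
        -- condition forces all of C ∩ Y into the intersection of the selection, hence into P.
        thin-member-shared : ∀ {m Y b} → m ≢ j → Y ∈ F m → length (C ∩ᴾ Y) ≤ t → b ∈ C ∩ᴾ Y →
                             ∀ l → l ≢ j → l ≢ m → All (b ∈_) (F l)
        thin-member-shared {m} {Y} {b} m≢j Y∈ thin b∈ l l≢j l≢m = All.tabulate b∈P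
          where
          b∈P : ∀ {P} → P ∈ F l → b ∈ P
          b∈P {P} P∈ = subst (b ∈_) (updateAt-updates l (Q₀ [ m ]≔ Y))
                         (∈-⋂-others⁻ (proj₂ (∈-∩ᴾ⁻ {C = C} b∈C∩⋂)) l l≢j)
            where
            Q = (Q₀ [ m ]≔ Y) [ l ]≔ P
            Qm≡Y : Q m ≡ Y
            Qm≡Y = trans (updateAt-minimal m l _ (l≢m ∘ sym)) (updateAt-updates m Q₀)
            C∩Y⊆C∩⋂ : C ∩ᴾ Y ⊆ C ∩ᴾ ⋂ (map Q (others j))
            C∩Y⊆C∩⋂ = subst (λ Z → C ∩ᴾ Z ⊆ C ∩ᴾ ⋂ (map Q (others j))) Qm≡Y
              (⊆∧length≤⇒⊇ _≟ᴮ_ (∩ᴾ-unique _ C!) (∩-others-⊆ Q m≢j)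
                (≤-trans (subst (λ Z → length (C ∩ᴾ Z) ≤ t) (sym Qm≡Y) thin)
                         (cover-selection (Selection-≔ (Selection-≔ sel₀ Y∈) P∈))))
            b∈C∩⋂ = C∩Y⊆C∩⋂ b∈

        thin-members-same-index : CrossIntersecting t F → NonTrivial t F → length G ≤ t →
                                  ∀ {i₁ i₂ A B} → i₁ ≢ j → i₂ ≢ j → A ∈ F i₁ → B ∈ F i₂ →
                                  length (C ∩ᴾ A) ≤ t → length (C ∩ᴾ B) ≤ t → i₁ ≡ i₂
        thin-members-same-index cross nonTrivial |G|≤t {i₁} {i₂} {A} {B} i₁≢j i₂≢j A∈ B∈ thinA thinB
          with i₁ ≟ i₂
        ... | yes i₁≡i₂ = i₁≡i₂
        ... | no i₁≢i₂ = ⊥-elim (<⇒≱ (common-length<t nonTrivial (∩ᴾ-unique B C!) C∩B≠∅ common)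
                                     (cover-meets i₂≢j B∈))
          where
          C∩B≠∅ : All Nonempty (C ∩ᴾ B)
          C∩B≠∅ = All.tabulate (All.lookup (proj₁ (proj₂ (proj₁ cover))) ∘ proj₁ ∘ ∈-∩ᴾ⁻ {C = C})
          common-away : ∀ {b} → b ∈ C ∩ᴾ B → ∀ l → l ≢ j → All (b ∈_) (F l)
          common-away b∈ l l≢j with l ≟ i₂
          ... | no l≢i₂ = thin-member-shared i₂≢j B∈ thinB b∈ l l≢j l≢i₂
          ... | yes refl = thin-member-shared i₁≢j A∈ thinA b∈C∩A l l≢j (i₁≢i₂ ∘ sym)
            where
            b∈C∩A = ∈-∩ᴾ⁺ (proj₁ (∈-∩ᴾ⁻ {C = C} b∈))
                          (All.lookup (thin-member-shared i₂≢j B∈ thinB b∈ i₁ i₁≢j i₁≢i₂) A∈)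
          common : ∀ {b} → b ∈ C ∩ᴾ B → Common b
          common b∈ = common-away-from⇒common cross g |G|≤t (All.lookup C∩B≠∅ b∈) (common-away b∈)

      module _ {t} (cross : CrossIntersecting t F) (nonTrivial : NonTrivial t F)
               (attained : ∀ i → ∃ λ G → 𝒢 F i G × length G ≡ t) where

        t-cover-𝒢-thick-but-one : ∀ j C → IsCover t (𝒢 F j) C → ∀ i₁ i₂ → i₁ ≢ j → i₂ ≢ j →
                                  ¬ IsCover (t + 1) ⟨ F i₁ ⟩ C →
                                  ¬ IsCover (t + 1) ⟨ F i₂ ⟩ C → i₁ ≡ i₂
        t-cover-𝒢-thick-but-one j C cover i₁ i₂ i₁≢j i₂≢j ¬cover₁ ¬cover₂
          with attained j
             | ¬IsCover⇒thin-member (t + 1) (F i₁) (proj₁ cover) ¬cover₁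
             | ¬IsCover⇒thin-member (t + 1) (F i₂) (proj₁ cover) ¬cover₂
        ... | G , g , |G|≡t | A , A∈ , thinA | B , B∈ , thinB =
          thin-members-same-index cover g cross nonTrivial (≤-reflexive |G|≡t)
                                  i₁≢j i₂≢j A∈ B∈ (<t+1⇒≤t thinA) (<t+1⇒≤t thinB)
          where
          <t+1⇒≤t : ∀ {m} → m < t + 1 → m ≤ t
          <t+1⇒≤t {m} m<t+1 = m<1+n⇒m≤n (subst (m <_) (+-comm t 1) m<t+1)

        τ-ℱ : (∀ {l P} → P ∈ F l → IsPartialPartition P) → ∀ i {l} → l ≢ i → τ≡ t ⟨ F i ⟩ t
        τ-ℱ partial i {l} l≢i with attained i | attained l
        ... | G , g , |G|≡t | _ , (_ , sel , _) , _ =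
          (G , G-cover , |G|≡t) , λ _ → cover-length (sel i (l≢i ∘ sym))
          where
          G-cover : IsCover t ⟨ F i ⟩ G
          G-cover = 𝒢-partial partial g l≢i , λ P P∈ → ≤-trans (≤-reflexive (sym |G|≡t))
            (length-mono-⊆ _≟ᴮ_ (𝒢-unique g)
              (λ b∈ → ∈-∩ᴾ⁺ b∈ (small-𝒢-⊆ cross g (≤-reflexive |G|≡t) P∈ b∈)))

        t-cover-𝒢-length≰t+1 : ∀ {i C} → IsCover t (𝒢 F i) C → ¬ length C ≤ t + 1
        t-cover-𝒢-length≰t+1 {i} {C} cover |C|≤t+1 with attained i
        ... | G , g , |G|≡t = <⇒≱ (common-length<t nonTrivial (𝒢-unique g) (𝒢-nonempty g) common)
                                   (≤-reflexive (sym |G|≡t))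
          where
          C! : Unique C
          C! = proj₁ (proj₁ cover)
          G⊆C : G ⊆ C
          G⊆C = ∩ᴾ-full⇒⊇ C! (≤-trans (≤-reflexive |G|≡t) (proj₂ cover G g))
          Thick : Fin r → Set
          Thick l = l ≡ i ⊎ IsCover (t + 1) ⟨ F l ⟩ C
          thick? : Decidable Thick
          thick? l = (l ≟ i) ⊎-dec IsCover? (t + 1) (F l) (proj₁ cover)
          thin-unique : ∀ l₁ l₂ → ¬ Thick l₁ → ¬ Thick l₂ → l₁ ≡ l₂
          thin-unique l₁ l₂ ¬thick₁ ¬thick₂ = t-cover-𝒢-thick-but-one i C cover l₁ l₂
            (¬thick₁ ∘ inj₁) (¬thick₂ ∘ inj₁) (¬thick₁ ∘ inj₂) (¬thick₂ ∘ inj₂)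
          l′ = proj₁ (all-but-one thick? i thin-unique)
          -- C has at most t + 1 blocks, so a (t + 1)-cover of ℱ_l lies inside every member.
          common-away : ∀ {b} → b ∈ G → ∀ l → l ≢ l′ → All (b ∈_) (F l)
          common-away b∈ l l≢l′ with proj₂ (all-but-one thick? i thin-unique) l l≢l′
          ... | inj₁ refl = All.tabulate λ P∈ → small-𝒢-⊆ cross g (≤-reflexive |G|≡t) P∈ b∈
          ... | inj₂ thick = All.tabulate λ P∈ →
            ∩ᴾ-full⇒⊆ C! (≤-trans |C|≤t+1 (proj₂ thick _ P∈)) (G⊆C b∈)
          common : ∀ {b} → b ∈ G → Common b
          common b∈ with attained l′
          ... | _ , g′ , |G′|≡t = common-away-from⇒common cross g′ (≤-reflexive |G′|≡t)
                                    (All.lookup (𝒢-nonempty g) b∈) (common-away b∈)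

        τ-𝒢 : ∀ i → τ≥ t (𝒢 F i) (t + 2)
        τ-𝒢 i C cover with t + 2 ≤? length C
        ... | yes long = long
        ... | no ¬long = ⊥-elim (t-cover-𝒢-length≰t+1 cover
                                   (m<1+n⇒m≤n (subst (length C <_) (+-suc t 1) (≰⇒> ¬long))))

lemma4p3 : (r t n : ℕ) (k : Fin r → ℕ) (F : Fin r → List (List (Block n))) →
    3 ≤ r → 1 ≤ t →
    (∀ i → k i < n) → (∀ i j → i ≤ᶠ j → k j ≤ k i) → (∀ i → t + 2 ≤ k i) →
    (∀ i → All (IsPartition n (k i)) (F i)) →
    CrossIntersecting t F → NonTrivial t F →
    (∀ i → MinSize≡ (𝒢 F i) t) →
    (∀ j C → IsCover t (𝒢 F j) C →
      ∀ i₁ i₂ → i₁ ≢ j → i₂ ≢ j →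
      ¬ IsCover (t + 1) ⟨ F i₁ ⟩ C → ¬ IsCover (t + 1) ⟨ F i₂ ⟩ C → i₁ ≡ i₂)
    × (∀ i → τ≡ t ⟨ F i ⟩ t × τ≥ t (𝒢 F i) (t + 2))
lemma4p3 r t n k F 3≤r _ _ _ _ partitions cross nonTrivial minSize =
  t-cover-𝒢-thick-but-one F cross nonTrivial attained ,
  λ i → τ-ℱ F cross nonTrivial attained partial i (proj₂ (another (<⇒≤ 3≤r) i)) ,
        τ-𝒢 F cross nonTrivial attained i
  where
  attained : ∀ i → ∃ λ G → 𝒢 F i G × length G ≡ t
  attained = proj₁ ∘ minSize
  partial : ∀ {l P} → P ∈ F l → IsPartialPartition P
  partial {l} P∈ = proj₁ (All.lookup (partitions l) P∈)
  another : ∀ {r} → 2 ≤ r → (i : Fin r) → ∃ λ l → l ≢ i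
  another (s≤s (s≤s _)) fzero = fsuc fzero , λ ()
  another (s≤s (s≤s _)) (fsuc i) = fzero , λ ()
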